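{- Let $v_i$ and $v_j$ be adjacent vertices of a rectangular dualizable graph $\mathcal{G}$ and let $s=|N(v_i)\cap N(v_j)|$. If $s=0$, then $(v_i,v_j)$ is an exterior edge of $\mathcal{G}$.
   Context: All graphs considered are connected plane graphs whose interior faces (regions) are all triangles. A planar graph is a rectangular dualizable graph (RDG) if its dual graph can be realized as a rectangular floorplan (a partition of a rectangle into rectangles such that no four of them meet at a point); equivalently its dual is a plane graph whose edges can be oriented horizontally or vertically, with four-sided internal regions and a rectangular enclosure. $N(v)$ denotes the set of neighbours of $v$. An exterior edge is an edge lying on the exterior (unbounded) face.
   Formalization: The rectangles of the floorplan witnessing that $\mathcal{G}$ is a rectangular dualizable graph, including the enclosing rectangle, have rational coordinates. -}

module Defs where

open import Data.Nat using (ℕ; zero; suc; _+_; _*_)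
open import Data.Fin using (Fin)
open import Data.Product using (Σ; ∃; ∃-syntax; _×_; _,_)
open import Data.Sum using (_⊎_)
open import Relation.Binary.PropositionalEquality using (_≡_; _≢_)
open import Relation.Nullary using (¬_)
open import Relation.Binary.Construct.Closure.ReflexiveTransitive using (Star)
open import Data.Rational using (ℚ; _<_; _≤_)

iter : {A : Set} → (A → A) → ℕ → A → A
iter f zero    x = x
iter f (suc k) x = f (iter f k x)

SameOrbit : {A : Set} → (A → A) → A → A → Set
SameOrbit f x y = ∃[ k ] iter f k x ≡ y

-- Connected simple plane graphs, encoded as combinatorial maps
-- (rotation systems).  Vertices are Fin n, darts (half-edges) are Fin d.
--   α  : dart ↦ opposite dart of the same edge (fixed-point-free involution)
--   σ  : dart ↦ next dart in the cyclic order around its tail vertex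
--   φ = σ ∘ α : face permutation; faces are the φ-orbits, labelled by Fin f.
-- Planarity = genus 0 = Euler's formula  n − (d/2) + f = 2.
-- One face label, 'outer', is the exterior (unbounded) face; every other
-- (interior) face is a triangle.

record PlaneGraph (n : ℕ) : Set where
  field
    d f        : ℕ
    α σ σ⁻     : Fin d → Fin d
    tail       : Fin d → Fin n
    face       : Fin d → Fin f
    outer      : Fin f
    α-invol    : ∀ x → α (α x) ≡ x
    α-nofix    : ∀ x → α x ≢ x
    σ-left     : ∀ x → σ⁻ (σ x) ≡ x
    σ-right    : ∀ x → σ (σ⁻ x) ≡ x
    tail-σ     : ∀ x → tail (σ x) ≡ tail x
    tail-orbit : ∀ x y → tail x ≡ tail y → SameOrbit σ x y
    tail-onto  : ∀ v → ∃[ x ] tail x ≡ v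
    face-φ     : ∀ x → face (σ (α x)) ≡ face x
    face-orbit : ∀ x y → face x ≡ face y → SameOrbit (λ z → σ (α z)) x y
    face-onto  : ∀ i → ∃[ x ] face x ≡ i
    no-loop    : ∀ x → tail (α x) ≢ tail x
    no-multi   : ∀ x y → tail x ≡ tail y → tail (α x) ≡ tail (α y) → x ≡ y
    connected  : ∀ u v → Star (λ a b → ∃[ x ] (tail x ≡ a × tail (α x) ≡ b)) u v
    euler      : 2 * (n + f) ≡ 4 + d
    -- every interior face is a triangle (a φ-orbit of length 3;
    -- length 1 is impossible by no-loop)
    triangles  : ∀ x → face x ≢ outer → iter (λ z → σ (α z)) 3 x ≡ x

module _ {n : ℕ} (G : PlaneGraph n) where
  open PlaneGraph G

  Adjacent : Fin n → Fin n → Set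
  Adjacent u v = ∃[ x ] (tail x ≡ u × tail (α x) ≡ v)

  CommonNeighbour : Fin n → Fin n → Fin n → Set
  CommonNeighbour u v w = Adjacent u w × Adjacent v w

  ExteriorEdge : Fin n → Fin n → Set
  ExteriorEdge u v =
    ∃[ x ] (tail x ≡ u × tail (α x) ≡ v × (face x ≡ outer ⊎ face (α x) ≡ outer))

record Rect : Set where
  field
    x₁ x₂ y₁ y₂ : ℚ
    x₁<x₂       : x₁ < x₂
    y₁<y₂       : y₁ < y₂

open Rect

_∈R_ : ℚ × ℚ → Rect → Set
(p , q) ∈R r = (x₁ r ≤ p × p ≤ x₂ r) × (y₁ r ≤ q × q ≤ y₂ r)

_⊆R_ : Rect → Rect → Set
r ⊆R s = x₁ s ≤ x₁ r × x₂ r ≤ x₂ s × y₁ s ≤ y₁ r × y₂ r ≤ y₂ s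

InteriorDisjoint : Rect → Rect → Set
InteriorDisjoint r s = x₂ r ≤ x₁ s ⊎ x₂ s ≤ x₁ r ⊎ y₂ r ≤ y₁ s ⊎ y₂ s ≤ y₁ r

SharesSide : Rect → Rect → Set
SharesSide r s =
    ((x₂ r ≡ x₁ s ⊎ x₂ s ≡ x₁ r) × y₁ r < y₂ s × y₁ s < y₂ r)
  ⊎ ((y₂ r ≡ y₁ s ⊎ y₂ s ≡ y₁ r) × x₁ r < x₂ s × x₁ s < x₂ r)

record RectangularDual {n : ℕ} (G : PlaneGraph n) : Set where
  field
    B        : Rect
    R        : Fin n → Rect
    inside   : ∀ v → R v ⊆R B
    disjoint : ∀ u v → u ≢ v → InteriorDisjoint (R u) (R v)
    cover    : ∀ p → p ∈R B → ∃[ v ] p ∈R R v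
    no-four  : ∀ p a b c e → a ≢ b → a ≢ c → a ≢ e → b ≢ c → b ≢ e → c ≢ e →
               ¬ (p ∈R R a × p ∈R R b × p ∈R R c × p ∈R R e)
    adj⇒side : ∀ u v → Adjacent G u v → SharesSide (R u) (R v)
    side⇒adj : ∀ u v → u ≢ v → SharesSide (R u) (R v) → Adjacent G u v

RDG : {n : ℕ} → PlaneGraph n → Set
RDG G = RectangularDual G

{-# OPTIONS --safe #-}
-- An edge x = (u, v) whose face is interior lies on a triangle u → v → w → u
-- of the face permutation φ = σ ∘ α, and the third corner w is adjacent to
-- both u and v. So an edge without common neighbours borders the exterior
-- face.
module Submission where

open import Defs
open import Data.Nat using (ℕ)
open import Data.Fin using (Fin; _≟_)
open import Data.Product using (_,_)
open import Data.Sum using (inj₁)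
open import Data.Empty using (⊥-elim)
open import Relation.Nullary using (¬_; yes; no)
open import Relation.Binary.PropositionalEquality using (_≡_; _≢_; refl; sym; cong; module ≡-Reasoning)

module _ {n : ℕ} (G : PlaneGraph n) where
  open PlaneGraph G

  φ : Fin d → Fin d
  φ x = σ (α x)

  tail-φ : ∀ x → tail (φ x) ≡ tail (α x)
  tail-φ x = tail-σ (α x)

  adjacent-tail-φ : ∀ x → Adjacent G (tail (α x)) (tail (α (φ x)))
  adjacent-tail-φ x = φ x , tail-φ x , refl

  φ³-fixed⇒adjacent-tail-α-φ : ∀ x → iter φ 3 x ≡ x →
                             Adjacent G (tail x) (tail (α (φ x)))
  φ³-fixed⇒adjacent-tail-α-φ x φ³x≡x = α (φ (φ x)) , tail-start , tail-end
    where
    open ≡-Reasoning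
    tail-start : tail (α (φ (φ x))) ≡ tail x
    tail-start = begin
      tail (α (φ (φ x)))    ≡⟨ sym (tail-φ (φ (φ x))) ⟩
      tail (φ (φ (φ x)))    ≡⟨ cong tail φ³x≡x ⟩
      tail x                ∎
    tail-end : tail (α (α (φ (φ x)))) ≡ tail (α (φ x))
    tail-end = begin
      tail (α (α (φ (φ x))))  ≡⟨ cong tail (α-invol (φ (φ x))) ⟩
      tail (φ (φ x))          ≡⟨ tail-φ (φ x) ⟩
      tail (α (φ x))          ∎

  interior-edge-common-neighbour : ∀ x → face x ≢ outer →
    CommonNeighbour G (tail x) (tail (α x)) (tail (α (φ x)))
  interior-edge-common-neighbour x interior =
    φ³-fixed⇒adjacent-tail-α-φ x (triangles x interior) , adjacent-tail-φ x

lemma4p1 : {n : ℕ} (G : PlaneGraph n) → RDG G →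
           (vi vj : Fin n) → Adjacent G vi vj →
           (∀ w → ¬ CommonNeighbour G vi vj w) →
           ExteriorEdge G vi vj
lemma4p1 G _ vi vj (x , refl , refl) no-common with PlaneGraph.face G x ≟ PlaneGraph.outer G
... | yes exterior = x , refl , refl , inj₁ exterior
... | no interior   = ⊥-elim (no-common _ (interior-edge-common-neighbour G x interior))
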